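{- Let $P$ be a finite poset with an element $s\in P$ such that (i) for all $a\in P$, $a\vee s$ exists or $a\wedge s$ exists; and (ii) for all $a,b\in P$, if $a>b$, $a\vee s$ does not exist and $b\vee s$ does exist, then $a\wedge(b\vee s)$ exists. Let $r$ be a minimal element of $P\setminus({\uparrow} s\cup{\downarrow} s)$. Then every lower cover of $r$ lies in $({\downarrow} s)\setminus\{s\}$.
   Context: ${\uparrow} s=\{w\in P\mid s\le w\}$, ${\downarrow} s=\{w\in P\mid w\le s\}$. $x$ is a lower cover of $y$ if $x<y$ and there is no $z$ with $x<z<y$. Joins and meets are taken in $P$. -}

module Defs where

open import Level using (Level; _⊔_)
open import Data.Product using (Σ; _×_)
open import Data.List using (List)
open import Data.List.Relation.Unary.Any using (Any)
open import Relation.Nullary using (¬_)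
open import Relation.Binary.Bundles using (DecPoset)

module _ {c ℓ₁ ℓ₂ : Level} (P : DecPoset c ℓ₁ ℓ₂) where
  open DecPoset P

  Finite : Set (c ⊔ ℓ₁)
  Finite = Σ (List Carrier) λ xs → ∀ x → Any (x ≈_) xs

  _⊏_ : Carrier → Carrier → Set (ℓ₁ ⊔ ℓ₂)
  x ⊏ y = x ≤ y × ¬ (x ≈ y)

  IsJoin : Carrier → Carrier → Carrier → Set (c ⊔ ℓ₂)
  IsJoin a b j = a ≤ j × b ≤ j × (∀ u → a ≤ u → b ≤ u → j ≤ u)

  IsMeet : Carrier → Carrier → Carrier → Set (c ⊔ ℓ₂)
  IsMeet a b m = m ≤ a × m ≤ b × (∀ l → l ≤ a → l ≤ b → l ≤ m)

  JoinExists : Carrier → Carrier → Set (c ⊔ ℓ₂)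
  JoinExists a b = Σ Carrier (IsJoin a b)

  MeetExists : Carrier → Carrier → Set (c ⊔ ℓ₂)
  MeetExists a b = Σ Carrier (IsMeet a b)

  Incomparable : Carrier → Carrier → Set ℓ₂
  Incomparable s w = ¬ (s ≤ w) × ¬ (w ≤ s)

  MinimalIncomparable : Carrier → Carrier → Set (c ⊔ ℓ₁ ⊔ ℓ₂)
  MinimalIncomparable s r = Incomparable s r × (∀ w → w ⊏ r → ¬ Incomparable s w)

  LowerCover : Carrier → Carrier → Set (c ⊔ ℓ₁ ⊔ ℓ₂)
  LowerCover x y = x ⊏ y × (∀ z → ¬ (x ⊏ z × z ⊏ y))

module Submission where

open import Defs
open import Data.Empty using (⊥-elim)
open import Data.Product using (_×_; _,_)
open import Data.Sum using (_⊎_)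
open import Relation.Nullary using (¬_; yes; no)
open import Relation.Binary.Bundles using (DecPoset)

module _ {c ℓ₁ ℓ₂} (P : DecPoset c ℓ₁ ℓ₂) where
  open DecPoset P

  -- Minimality makes w comparable with s, and s ≤ w is ruled out because s ≰ r.
  ⊏-minimalIncomparable⇒⊏ : ∀ {s r w} → MinimalIncomparable P s r →
                            _⊏_ P w r → _⊏_ P w s
  ⊏-minimalIncomparable⇒⊏ {s} {r} {w} ((s≰r , _) , minimal) w⊏r@(w≤r , _)
    with w ≤? s
  ... | yes w≤s = w≤s , λ w≈s → s≰r (trans (reflexive (Eq.sym w≈s)) w≤r)
  ... | no w≰s  = ⊥-elim (minimal w w⊏r ((λ s≤w → s≰r (trans s≤w w≤r)) , w≰s))

lemma11 : ∀ {c ℓ₁ ℓ₂} (P : DecPoset c ℓ₁ ℓ₂) → Finite P →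
    (s : DecPoset.Carrier P) →
    (∀ a → JoinExists P a s ⊎ MeetExists P a s) →
    (∀ a b → _⊏_ P b a → ¬ JoinExists P a s →
      ∀ j → IsJoin P b s j → MeetExists P a j) →
    (r : DecPoset.Carrier P) → MinimalIncomparable P s r →
    ∀ x → LowerCover P x r →
    DecPoset._≤_ P x s × ¬ DecPoset._≈_ P x s
lemma11 P _ s _ _ r minimal x (x⊏r , _) = ⊏-minimalIncomparable⇒⊏ P minimal x⊏r
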